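{- Let $G$ be a connected graph and $H=G_\ell$ its $\ell$-subdivision for some integer $\ell\ge1$. For integers $m,k$, if $G$ has an $m$-cover of size $k$, then $H$ has an $(m\ell+\lfloor\ell/2\rfloor)$-cover of size $k$.
   Context: The $\ell$-subdivision $G_\ell$ of $G$ is obtained by replacing every edge of $G$ by a path of length $\ell$; the vertices of $G$ in $G_\ell$ are called original vertices. An isometric path is a shortest path. For an integer $R$, an $R$-cover of a graph is a collection of isometric paths such that every vertex is at distance at most $R$ from the vertex set of some path in the collection; its size is the number of paths. -}

module Defs where

open import Data.Nat using (ℕ; zero; suc; _+_; _*_; _∸_; _≤_; _<_; _<ᵇ_)
open import Data.Nat.Properties using (_<?_)
open import Data.Fin using (Fin; toℕ; fromℕ<)
open import Data.Bool using (Bool; true; false; T; _∧_)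
open import Data.List using (List; []; _∷_)
open import Data.List.Membership.Propositional using (_∈_)
open import Data.Product using (Σ; ∃; ∃-syntax; _×_; _,_)
open import Data.Sum using (_⊎_; inj₁; inj₂)
open import Relation.Nullary using (yes; no)
open import Relation.Binary.PropositionalEquality using (_≡_)

data Walk {V : Set} (Adj : V → V → Set) : V → V → ℕ → Set where
  nil  : ∀ {x} → Walk Adj x x 0
  cons : ∀ {x y z k} → Adj x y → Walk Adj y z k → Walk Adj x z (suc k)

verts : ∀ {V : Set} {Adj : V → V → Set} {x y : V} {k : ℕ} → Walk Adj x y k → List V
verts {x = x} nil = x ∷ []
verts {x = x} (cons _ w) = x ∷ verts w

DistLe : {V : Set} (Adj : V → V → Set) → V → V → ℕ → Set
DistLe Adj x y d = ∃[ k ] (k ≤ d × Walk Adj x y k)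

Connected : {V : Set} (Adj : V → V → Set) → Set
Connected {V} Adj = (x y : V) → ∃[ k ] Walk Adj x y k

record IsoPath {V : Set} (Adj : V → V → Set) : Set where
  field
    start end : V
    len       : ℕ
    walk      : Walk Adj start end len
    shortest  : ∀ k′ → Walk Adj start end k′ → len ≤ k′

HasCover : {V : Set} (Adj : V → V → Set) → (R k : ℕ) → Set
HasCover {V} Adj R k =
  Σ (Fin k → IsoPath Adj) λ P →
    (z : V) → ∃[ i ] ∃[ w ] (w ∈ verts (IsoPath.walk (P i)) × DistLe Adj z w R)

record FinGraph : Set where
  field
    n          : ℕ
    adj        : Fin n → Fin n → Bool
    adj-sym    : ∀ u v → adj u v ≡ adj v u
    adj-irrefl : ∀ u → adj u u ≡ false

module _ (G : FinGraph) where
  open FinGraph G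

  Adj : Fin n → Fin n → Set
  Adj u v = T (adj u v)

  -- Edges {u,v}, each represented once, oriented so that u < v.
  Edge : Set
  Edge = Σ (Fin n) λ u → Σ (Fin n) λ v → T (adj u v ∧ (toℕ u <ᵇ toℕ v))

  -- Vertices of the ℓ-subdivision: original vertices, and for each edge
  -- the ℓ ∸ 1 internal vertices of the path replacing it.
  SubV : ℕ → Set
  SubV ℓ = Fin n ⊎ (Edge × Fin (ℓ ∸ 1))

  -- The vertex at position p (0 ≤ p ≤ ℓ) along the path replacing e,
  -- going from u (position 0) to v (position ℓ).
  at : (ℓ : ℕ) → Edge → ℕ → SubV ℓ
  at ℓ (u , v , _) zero = inj₁ u
  at ℓ e@(u , v , _) (suc p) with p <? ℓ ∸ 1
  ... | yes p<ℓ-1 = inj₂ (e , fromℕ< p<ℓ-1)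
  ... | no _      = inj₁ v

  SubStep : (ℓ : ℕ) → SubV ℓ → SubV ℓ → Set
  SubStep ℓ x y = ∃[ e ] ∃[ p ] (p < ℓ × x ≡ at ℓ e p × y ≡ at ℓ e (suc p))

  SubAdj : (ℓ : ℕ) → SubV ℓ → SubV ℓ → Set
  SubAdj ℓ x y = SubStep ℓ x y ⊎ SubStep ℓ y x

-- Lift every path of the cover edge by edge.  A lifted shortest path stays
-- shortest because distances between original vertices scale exactly by ℓ:
-- along any walk of length k from a vertex at position p of the subdivided
-- edge uv to an original vertex y, one has ℓ·d(u,y) ≤ k + p and
-- ℓ·d(v,y) + p ≤ k + ℓ, an invariant that survives each step.  An original
-- vertex is within mℓ of a lifted path, and an internal vertex lies within
-- ⌊ℓ/2⌋ of one of the two ends of its edge.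
module Submission where

open import Defs
open import Data.Nat
  using (ℕ; zero; suc; _+_; _*_; _∸_; _/_; _%_; _≤_; _<_; _≥_; _≤?_; z≤n; s≤s; s≤s⁻¹)
open import Data.Nat.Properties
open import Data.Nat.DivMod using (m≡m%n+[m/n]*n; m%n<n)
open import Data.Fin using (Fin; toℕ; fromℕ<)
open import Data.Fin.Properties using (toℕ-injective; toℕ<n; fromℕ<-toℕ; toℕ-fromℕ<)
open import Data.Bool using (T)
open import Data.Bool.Properties using (T-∧)
open import Function using (_∘_; case_of_; Equivalence)
open import Algebra.Properties.CommutativeSemigroup +-commutativeSemigroup using (xy∙z≈xz∙y)
open import Data.List.Membership.Propositional using (_∈_)
open import Data.List.Relation.Unary.Any using (here; there)
open import Data.Product using (∃-syntax; _×_; _,_; proj₁)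
open import Data.Sum using (_⊎_; inj₁; inj₂; swap)
open import Relation.Nullary using (yes; no; contradiction)
open import Relation.Binary.Definitions using (Symmetric)
open import Relation.Binary.PropositionalEquality

module _ {V : Set} {A : V → V → Set} where

  _++ʷ_ : ∀ {x y z a b} → Walk A x y a → Walk A y z b → Walk A x z (a + b)
  nil      ++ʷ w = w
  cons s v ++ʷ w = cons s (v ++ʷ w)

  _∷ʳʷ_ : ∀ {x y z k} → Walk A x y k → A y z → Walk A x z (suc k)
  nil      ∷ʳʷ s = cons s nil
  cons t w ∷ʳʷ s = cons t (w ∷ʳʷ s)

  reverseʷ : Symmetric A → ∀ {x y k} → Walk A x y k → Walk A y x k
  reverseʷ sym nil        = nil
  reverseʷ sym (cons s w) = reverseʷ sym w ∷ʳʷ sym s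

  start∈verts : ∀ {x y k} (w : Walk A x y k) → x ∈ verts w
  start∈verts nil        = here refl
  start∈verts (cons _ _) = here refl

  ∈verts-++ʳ : ∀ {x y z a b t} (v : Walk A x y a) (w : Walk A y z b) →
               t ∈ verts w → t ∈ verts (v ++ʷ w)
  ∈verts-++ʳ nil        w t∈w = t∈w
  ∈verts-++ʳ (cons _ v) w t∈w = there (∈verts-++ʳ v w t∈w)

  Covered : ∀ {k} → (Fin k → IsoPath A) → ℕ → V → Set
  Covered P R z = ∃[ i ] ∃[ w ] (w ∈ verts (IsoPath.walk (P i)) × DistLe A z w R)

  Covered-mono : ∀ {k} {P : Fin k → IsoPath A} {R R′ z} → R ≤ R′ →
                 Covered P R z → Covered P R′ z
  Covered-mono R≤R′ (i , w , w∈P , d , d≤R , walk) = i , w , w∈P , d , ≤-trans d≤R R≤R′ , walk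

  Covered-prepend : ∀ {k} {P : Fin k → IsoPath A} {R z z′ p} → Walk A z z′ p →
                    Covered P R z′ → Covered P (p + R) z
  Covered-prepend {p = p} v (i , w , w∈P , d , d≤R , walk) =
    i , w , w∈P , p + d , +-monoʳ-≤ p d≤R , v ++ʷ walk

n≤1+[n/2]+[n/2] : ∀ n → n ≤ suc (n / 2 + n / 2)
n≤1+[n/2]+[n/2] n = begin
  n                   ≡⟨ m≡m%n+[m/n]*n n 2 ⟩
  n % 2 + n / 2 * 2   ≤⟨ +-monoˡ-≤ (n / 2 * 2) (s≤s⁻¹ (m%n<n n 2)) ⟩
  1 + n / 2 * 2       ≡⟨ cong suc (*-comm (n / 2) 2) ⟩
  1 + 2 * (n / 2)     ≡⟨ cong (λ h → suc (n / 2 + h)) (+-identityʳ (n / 2)) ⟩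
  suc (n / 2 + n / 2) ∎
  where open ≤-Reasoning

m≤n/2⊎n∸m≤n/2 : ∀ n p → p ≤ n / 2 ⊎ n ∸ p ≤ n / 2
m≤n/2⊎n∸m≤n/2 n p with p ≤? n / 2
... | yes p≤h = inj₁ p≤h
... | no  p≰h = inj₂ (m≤n+o⇒m∸n≤o n p (begin
  n                   ≤⟨ n≤1+[n/2]+[n/2] n ⟩
  suc (n / 2 + n / 2) ≡⟨ +-comm (suc (n / 2)) (n / 2) ⟩
  n / 2 + suc (n / 2) ≤⟨ +-monoʳ-≤ (n / 2) (≰⇒> p≰h) ⟩
  n / 2 + p           ≡⟨ +-comm (n / 2) p ⟩
  p + n / 2           ∎))
  where open ≤-Reasoning

module Subdivision (G : FinGraph) (l : ℕ) where
  open FinGraph G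

  ℓ : ℕ
  ℓ = suc l

  H : SubV G ℓ → SubV G ℓ → Set
  H = SubAdj G ℓ

  source target : Edge G → Fin n
  source (u , _ , _) = u
  target (_ , v , _) = v

  source-target : (e : Edge G) → Adj G (source e) (target e)
  source-target (_ , _ , h) = proj₁ (Equivalence.to T-∧ h)

  Adj-sym : ∀ {x y} → Adj G x y → Adj G y x
  Adj-sym {x} {y} = subst T (adj-sym x y)

  Adj⇒toℕ≢ : ∀ {x y} → Adj G x y → toℕ x ≢ toℕ y
  Adj⇒toℕ≢ {x} xy eq with toℕ-injective eq
  ... | refl = subst T (adj-irrefl x) xy

  edge : ∀ {x y} → Adj G x y → toℕ x < toℕ y → Edge G
  edge {x} {y} xy x<y = x , y , Equivalence.from T-∧ (xy , <⇒<ᵇ x<y)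

  H-sym : Symmetric H
  H-sym = swap

  at-ℓ : (e : Edge G) → at G ℓ e ℓ ≡ inj₁ (target e)
  at-ℓ (u , v , _) with l <? l
  ... | yes l<l = contradiction l<l (n≮n l)
  ... | no  _   = refl

  at-1+toℕ : (e : Edge G) (i : Fin l) → at G ℓ e (suc (toℕ i)) ≡ inj₂ (e , i)
  at-1+toℕ e@(u , v , _) i with toℕ i <? l
  ... | yes i<l = cong (λ j → inj₂ (e , j)) (fromℕ<-toℕ i i<l)
  ... | no  i≮l = contradiction (toℕ<n i) i≮l

  data AtView (e : Edge G) : ℕ → SubV G ℓ → Set where
    at-source : AtView e 0 (inj₁ (source e))
    at-inner  : (i : Fin l) → AtView e (suc (toℕ i)) (inj₂ (e , i))
    at-target : AtView e ℓ (inj₁ (target e))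

  at-view : (e : Edge G) (p : ℕ) → p ≤ ℓ → AtView e p (at G ℓ e p)
  at-view (u , v , h) zero _ = at-source
  at-view e (suc p) (s≤s p≤l) with m≤n⇒m<n∨m≡n p≤l
  ... | inj₁ p<l = subst (λ q → AtView e q (at G ℓ e q)) (cong suc (toℕ-fromℕ< p<l))
                     (subst (AtView e _) (sym (at-1+toℕ e i)) (at-inner i))
    where i = fromℕ< p<l
  ... | inj₂ refl = subst (AtView e ℓ) (sym (at-ℓ e)) at-target

  along : (e : Edge G) (p d : ℕ) → d + p ≤ ℓ → Walk H (at G ℓ e p) (at G ℓ e (d + p)) d
  along e p zero    _      = nil
  along e p (suc d) d+p<ℓ = along e p d (<⇒≤ d+p<ℓ) ∷ʳʷ inj₁ (e , d + p , d+p<ℓ , refl , refl)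

  toTarget : (e : Edge G) (p : ℕ) → p ≤ ℓ → Walk H (at G ℓ e p) (inj₁ (target e)) (ℓ ∸ p)
  toTarget e p p≤ℓ = subst (λ z → Walk H (at G ℓ e p) z (ℓ ∸ p))
    (trans (cong (at G ℓ e) (m∸n+n≡m p≤ℓ)) (at-ℓ e))
    (along e p (ℓ ∸ p) (≤-reflexive (m∸n+n≡m p≤ℓ)))

  innerToTarget : (e : Edge G) (i : Fin l) →
                  Walk H (inj₂ (e , i)) (inj₁ (target e)) (ℓ ∸ suc (toℕ i))
  innerToTarget e i = subst (λ z → Walk H z (inj₁ (target e)) _) (at-1+toℕ e i)
    (toTarget e _ (s≤s (<⇒≤ (toℕ<n i))))

  innerToSource : (e : Edge G) (i : Fin l) →
                  Walk H (inj₂ (e , i)) (inj₁ (source e)) (suc (toℕ i))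
  innerToSource e@(u , v , _) i = reverseʷ H-sym (subst (λ z → Walk H (inj₁ u) z p)
    (trans (cong (at G ℓ e) (+-identityʳ p)) (at-1+toℕ e i))
    (along e 0 p (≤-trans (≤-reflexive (+-identityʳ p)) (s≤s (<⇒≤ (toℕ<n i))))))
    where p = suc (toℕ i)

  edgeWalk : ∀ {x y} → Adj G x y → Walk H (inj₁ x) (inj₁ y) ℓ
  edgeWalk {x} {y} xy with toℕ x <? toℕ y
  ... | yes x<y = toTarget (edge xy x<y) 0 z≤n
  ... | no  x≮y = reverseʷ H-sym (toTarget (edge (Adj-sym xy) y<x) 0 z≤n)
    where y<x = ≤∧≢⇒< (≮⇒≥ x≮y) (Adj⇒toℕ≢ (Adj-sym xy))

  liftʷ : ∀ {x y d} → Walk (Adj G) x y d → Walk H (inj₁ x) (inj₁ y) (d * ℓ)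
  liftʷ nil         = nil
  liftʷ (cons xy w) = edgeWalk xy ++ʷ liftʷ w

  ∈verts-liftʷ : ∀ {x y d t} (w : Walk (Adj G) x y d) → t ∈ verts w → inj₁ t ∈ verts (liftʷ w)
  ∈verts-liftʷ nil         (here refl) = here refl
  ∈verts-liftʷ (cons xy w) (here refl) = start∈verts (edgeWalk xy ++ʷ liftʷ w)
  ∈verts-liftʷ (cons xy w) (there t∈w) = ∈verts-++ʳ (edgeWalk xy) (liftʷ w) (∈verts-liftʷ w t∈w)

  module Contraction (y : Fin n) where
    Within : ℕ → ℕ → Fin n → Set
    Within a b x = ∃[ j ] (j * ℓ + a ≤ b × Walk (Adj G) x y j)

    Within-weaken : ∀ {a b a′ b′ x} → a′ + b ≤ a + b′ → Within a b x → Within a′ b′ x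
    Within-weaken {a} {b} {a′} {b′} le (j , jℓ+a≤b , w) =
      j , +-cancelʳ-≤ a (j * ℓ + a′) b′ (begin
      j * ℓ + a′ + a ≡⟨ xy∙z≈xz∙y (j * ℓ) a′ a ⟩
      j * ℓ + a + a′ ≤⟨ +-monoˡ-≤ a′ jℓ+a≤b ⟩
      b + a′         ≡⟨ +-comm b a′ ⟩
      a′ + b         ≤⟨ le ⟩
      a + b′         ≡⟨ +-comm a b′ ⟩
      b′ + a         ∎) , w
      where open ≤-Reasoning

    Within-cons : ∀ {a b x x′} → Adj G x x′ → Within a b x′ → Within a (ℓ + b) x
    Within-cons {a} xx′ (j , jℓ+a≤b , w) =
      suc j , ≤-trans (≤-reflexive (+-assoc ℓ (j * ℓ) a)) (+-monoʳ-≤ ℓ jℓ+a≤b) , cons xx′ w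

    NearAt : Edge G → ℕ → ℕ → Set
    NearAt e p k = Within 0 (k + p) (source e) × Within p (k + ℓ) (target e)

    Near : ℕ → SubV G ℓ → Set
    Near k (inj₁ x)       = Within 0 k x
    Near k (inj₂ (e , i)) = NearAt e (suc (toℕ i)) k

    near⇒nearAt : ∀ {e p a k} → AtView e p a → Near k a → NearAt e p k
    near⇒nearAt {e} {k = k} at-source g =
      Within-weaken (m≤m+n k 0) g ,
      Within-weaken (≤-reflexive (+-comm ℓ k)) (Within-cons (Adj-sym (source-target e)) g)
    near⇒nearAt (at-inner i) g = g
    near⇒nearAt {e} {k = k} at-target g =
      Within-weaken (≤-reflexive (+-comm ℓ k)) (Within-cons (source-target e) g) ,
      Within-weaken (≤-reflexive (+-comm ℓ k)) g

    nearAt⇒near : ∀ {e p a k} → AtView e p a → NearAt e p k → Near k a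
    nearAt⇒near {k = k} at-source    (g , _) = Within-weaken (≤-reflexive (+-identityʳ k)) g
    nearAt⇒near         (at-inner i) g       = g
    nearAt⇒near {k = k} at-target    (_ , g) = Within-weaken (≤-reflexive (+-comm k ℓ)) g

    nearAt-step : ∀ {e p q k} → p ≤ suc q → q ≤ suc p → NearAt e q k → NearAt e p (suc k)
    nearAt-step {p = p} {q} {k} p≤1+q q≤1+p (gu , gv) =
      Within-weaken (≤-trans (+-monoʳ-≤ k q≤1+p) (≤-reflexive (+-suc k p))) gu ,
      Within-weaken (≤-trans (+-monoˡ-≤ (k + ℓ) p≤1+q) (≤-reflexive (sym (+-suc q (k + ℓ))))) gv

    across : ∀ {e p q a b k} → p ≤ suc q → q ≤ suc p → AtView e p a → AtView e q b →
             Near k b → Near (suc k) a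
    across {e} {k = k} p≤1+q q≤1+p view-a view-b g =
      nearAt⇒near {k = suc k} view-a (nearAt-step {e} {k = k} p≤1+q q≤1+p (near⇒nearAt view-b g))

    walk⇒near : ∀ {a k} → Walk H a (inj₁ y) k → Near k a
    walk⇒near nil = 0 , z≤n , nil
    walk⇒near (cons (inj₁ (e , q , q<ℓ , refl , refl)) w) =
      across (m≤n⇒m≤1+n (n≤1+n q)) ≤-refl
        (at-view e q (<⇒≤ q<ℓ)) (at-view e (suc q) q<ℓ) (walk⇒near w)
    walk⇒near (cons (inj₂ (e , q , q<ℓ , refl , refl)) w) =
      across ≤-refl (m≤n⇒m≤1+n (n≤1+n q))
        (at-view e (suc q) q<ℓ) (at-view e q (<⇒≤ q<ℓ)) (walk⇒near w)

  contract : ∀ {x y k} → Walk H (inj₁ x) (inj₁ y) k → ∃[ j ] (j * ℓ ≤ k × Walk (Adj G) x y j)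
  contract {y = y} w with Contraction.walk⇒near y w
  ... | j , jℓ+0≤k , v = j , ≤-trans (m≤m+n (j * ℓ) 0) jℓ+0≤k , v

  liftIso : IsoPath (Adj G) → IsoPath H
  liftIso P = record
    { walk     = liftʷ walk
    ; shortest = λ k′ w → case contract w of λ where
        (j , jℓ≤k′ , v) → ≤-trans (*-monoˡ-≤ ℓ (shortest j v)) jℓ≤k′
    }
    where open IsoPath P

  Covered-lift : ∀ {k} {P : Fin k → IsoPath (Adj G)} {R x} →
                 Covered P R x → Covered (liftIso ∘ P) (R * ℓ) (inj₁ x)
  Covered-lift {P = P} (i , w , w∈P , d , d≤R , walk) =
    i , inj₁ w , ∈verts-liftʷ (IsoPath.walk (P i)) w∈P , d * ℓ , *-monoˡ-≤ ℓ d≤R , liftʷ walk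

  lift-cover : ∀ {m k} → HasCover (Adj G) m k → HasCover H (m * ℓ + ℓ / 2) k
  lift-cover {m} {k} (P , covered) = P′ , covered′
    where
    P′ : Fin k → IsoPath H
    P′ = liftIso ∘ P

    within-half : ∀ {d} → d ≤ ℓ / 2 → d + m * ℓ ≤ m * ℓ + ℓ / 2
    within-half d≤h = ≤-trans (+-monoˡ-≤ (m * ℓ) d≤h) (≤-reflexive (+-comm (ℓ / 2) (m * ℓ)))

    covered′ : ∀ z → Covered P′ (m * ℓ + ℓ / 2) z
    covered′ (inj₁ x) =
      Covered-mono {P = P′} (m≤m+n (m * ℓ) (ℓ / 2)) (Covered-lift {P = P} (covered x))
    covered′ (inj₂ (e , i)) with m≤n/2⊎n∸m≤n/2 ℓ (suc (toℕ i))
    ... | inj₁ near-source = Covered-mono {P = P′} (within-half near-source)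
          (Covered-prepend {P = P′} (innerToSource e i) (Covered-lift {P = P} (covered (source e))))
    ... | inj₂ near-target = Covered-mono {P = P′} (within-half near-target)
          (Covered-prepend {P = P′} (innerToTarget e i) (Covered-lift {P = P} (covered (target e))))

lemma10 : (G : FinGraph) → Connected (Adj G) → (ℓ : ℕ) → ℓ ≥ 1 → (m k : ℕ) →
    HasCover (Adj G) m k → HasCover (SubAdj G ℓ) (m * ℓ + ℓ / 2) k
lemma10 G _ (suc l) _ m k = Subdivision.lift-cover G l
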